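{- Let $f:B\to A$ and $g:C\to A$ be two covers, and let $B\xleftarrow{p}U\xrightarrow{q}C$ be a pullback of $B\xrightarrow{f}A\xleftarrow{g}C$. If $i\in\Sigma(U)$ satisfies $\deg(q\circ i)>1$, then $|{\rm Hom}(g\circ q\circ i,f)|\ge|{\rm Hom}(g,f)|+1$.
   Context: Let $\mathbf C$ be a category and $\mathbf D$ a full subcategory of $\mathbf C$. For arrows $f,g$ of $\mathbf C$ with ${\rm cod}\,f={\rm cod}\,g$, ${\rm Hom}(g,f)$ denotes the collection of all arrows $h$ of $\mathbf C$ with $g=f\circ h$. Standing assumptions: (G1) every diagram $B\to A\leftarrow C$ in $\mathbf D$ has a pullback in $\mathbf C$. (G2) (I) pushouts exist in $\mathbf D$; (II) every arrow of $\mathbf D$ is epic; (III) every monic arrow of $\mathbf D$ is an isomorphism whose inverse is an arrow of $\mathbf D$. (G3) for every object $U$ of $\mathbf C$ there is a set $\Sigma(U)$ of arrows $i$ of $\mathbf C$ with ${\rm dom}\,i$ in $\mathbf D$ and ${\rm cod}\,i=U$ such that for every arrow $u$ of $\mathbf C$ with ${\rm dom}\,u$ in $\mathbf D$ and ${\rm cod}\,u=U$ there is exactly one $i\in\Sigma(U)$ with ${\rm Hom}(u,i)\neq\emptyset$. (G4) there is a function $\deg$ from the collection of arrows of $\mathbf C$ whose codomain lies in $\mathbf D$ to the positive integers such that (I) $\deg(g\circ f)=\deg g\cdot\deg f$ whenever $f,g,g\circ f$ all lie in this collection; (II) $\deg f=\sum_{i\in\Sigma({\rm dom}\,f)}\deg(f\circ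 i)$ for every such $f$; (III) if $B\xrightarrow{f}A\xleftarrow{g}C$ is a diagram in $\mathbf D$ with pullback $B\xleftarrow{p}U\xrightarrow{q}C$, then $\deg f=\deg q$ and $\deg g=\deg p$. A cover is an arrow of $\mathbf D$. -}

module Defs where

open import Level using (Level; _⊔_)
open import Data.Nat using (ℕ; zero; _+_; _*_; _<_)
open import Data.Fin using (Fin; zero; suc)
open import Data.Product using (Σ; _×_; _,_; proj₁; ∃)
open import Relation.Binary.PropositionalEquality using (_≡_)
open import Relation.Nullary using (¬_)
open import Function.Bundles using (_↔_; Inverse)

record Category (o ℓ : Level) : Set (Level.suc (o ⊔ ℓ)) where
  infixr 9 _∘_
  field
    Obj   : Set o
    Hom   : Obj → Obj → Set ℓ
    id    : ∀ {X} → Hom X X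
    _∘_   : ∀ {X Y Z} → Hom Y Z → Hom X Y → Hom X Z
    idˡ   : ∀ {X Y} (f : Hom X Y) → id ∘ f ≡ f
    idʳ   : ∀ {X Y} (f : Hom X Y) → f ∘ id ≡ f
    assoc : ∀ {W X Y Z} (h : Hom Y Z) (g : Hom X Y) (f : Hom W X)
            → (h ∘ g) ∘ f ≡ h ∘ (g ∘ f)

sumFin : (n : ℕ) → (Fin n → ℕ) → ℕ
sumFin zero    a = 0
sumFin (ℕ.suc n) a = a zero + sumFin n (λ k → a (suc k))

-- "|X| + 1 ≤ |Y|" (cardinal reading) for sets X, Y carrying an equality
-- relation: an injection X → Y together with an element of Y outside its image.
CardSucLE : ∀ {a b r s} (X : Set a) (_≈X_ : X → X → Set r)
            (Y : Set b) (_≈Y_ : Y → Y → Set s) → Set (a ⊔ b ⊔ r ⊔ s)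
CardSucLE X _≈X_ Y _≈Y_ =
  Σ (X → Y) λ φ →
    (∀ x x' → φ x ≈Y φ x' → x ≈X x') ×
    Σ Y (λ y → ∀ x → ¬ (φ x ≈Y y))

module CatDefs {o ℓ : Level} (𝒞 : Category o ℓ) where
  open Category 𝒞

  -- Hom(g, f) for f : B → A, g : C → A : the arrows h : C → B with g = f ∘ h.
  HomOver : ∀ {A B C} → Hom C A → Hom B A → Set ℓ
  HomOver {B = B} {C = C} g f = Σ (Hom C B) λ h → g ≡ f ∘ h

  _≈H_ : ∀ {A B C} {g : Hom C A} {f : Hom B A} → HomOver g f → HomOver g f → Set ℓ
  x ≈H y = proj₁ x ≡ proj₁ y

  HomCardSucLE : ∀ {A B C A' B' C'} (g : Hom C A) (f : Hom B A)
                 (g' : Hom C' A') (f' : Hom B' A') → Set ℓ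
  HomCardSucLE g f g' f' = CardSucLE (HomOver g f) _≈H_ (HomOver g' f') _≈H_

  record Pullback {A B C} (f : Hom B A) (g : Hom C A) : Set (o ⊔ ℓ) where
    field
      U    : Obj
      p    : Hom U B
      q    : Hom U C
      comm : f ∘ p ≡ g ∘ q
      universal : ∀ {W} (p' : Hom W B) (q' : Hom W C) → f ∘ p' ≡ g ∘ q' →
                  Σ (Hom W U) λ h → (p ∘ h ≡ p') × (q ∘ h ≡ q') ×
                    (∀ (h' : Hom W U) → p ∘ h' ≡ p' → q ∘ h' ≡ q' → h' ≡ h)

  module WithD {d : Level} (InD : Obj → Set d) where

    record PushoutInD {A B C} (f : Hom A B) (g : Hom A C) : Set (o ⊔ ℓ ⊔ d) where
      field
        P     : Obj
        P∈D   : InD P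
        ι₁    : Hom B P
        ι₂    : Hom C P
        comm  : ι₁ ∘ f ≡ ι₂ ∘ g
        universal : ∀ {W} → InD W → (j₁ : Hom B W) (j₂ : Hom C W) → j₁ ∘ f ≡ j₂ ∘ g →
                    Σ (Hom P W) λ h → (h ∘ ι₁ ≡ j₁) × (h ∘ ι₂ ≡ j₂) ×
                      (∀ (h' : Hom P W) → h' ∘ ι₁ ≡ j₁ → h' ∘ ι₂ ≡ j₂ → h' ≡ h)

    EpicInD : ∀ {X Y} → Hom X Y → Set (o ⊔ ℓ ⊔ d)
    EpicInD {Y = Y} e = ∀ {Z} → InD Z → (h k : Hom Y Z) → h ∘ e ≡ k ∘ e → h ≡ k

    MonicInD : ∀ {X Y} → Hom X Y → Set (o ⊔ ℓ ⊔ d)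
    MonicInD {X = X} m = ∀ {W} → InD W → (h k : Hom W X) → m ∘ h ≡ m ∘ k → h ≡ k

    IsIso : ∀ {X Y} → Hom X Y → Set ℓ
    IsIso {X} {Y} m = Σ (Hom Y X) λ m⁻¹ → (m⁻¹ ∘ m ≡ id) × (m ∘ m⁻¹ ≡ id)

  -- The standing assumptions (G1)–(G4) for a full subcategory D of 𝒞,
  -- given by the predicate InD on objects.
  record Setting (d s : Level) : Set (Level.suc (o ⊔ ℓ ⊔ d ⊔ s)) where
    field
      InD : Obj → Set d
    open WithD InD public
    field
      G1 : ∀ {A B C} → InD A → InD B → InD C →
           (f : Hom B A) (g : Hom C A) → Pullback f g
      G2-I   : ∀ {A B C} → InD A → InD B → InD C →
               (f : Hom A B) (g : Hom A C) → PushoutInD f g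
      G2-II  : ∀ {X Y} → InD X → InD Y → (e : Hom X Y) → EpicInD e
      -- (G2)(III)  (the inverse is automatically in D since D is full)
      G2-III : ∀ {X Y} → InD X → InD Y → (m : Hom X Y) → MonicInD m → IsIso m
      -- (G3) Σ(U), given as an indexed set of arrows into U with domain in D
      SigIdx : Obj → Set s
      sigDom : ∀ {U} → SigIdx U → Obj
      sigInD : ∀ {U} (j : SigIdx U) → InD (sigDom j)
      sigArr : ∀ {U} (j : SigIdx U) → Hom (sigDom j) U
      G3     : ∀ {U X} → InD X → (u : Hom X U) →
               Σ (SigIdx U) λ j → HomOver u (sigArr j) ×
                 (∀ (j' : SigIdx U) → HomOver u (sigArr j') → j' ≡ j)
      deg    : ∀ {X Y} → .(InD Y) → Hom X Y → ℕ
      deg-pos : ∀ {X Y} (y : InD Y) (f : Hom X Y) → 0 < deg y f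
      G4-I   : ∀ {X Y Z} (y : InD Y) (z : InD Z) (f : Hom X Y) (g : Hom Y Z) →
               deg z (g ∘ f) ≡ deg z g * deg y f
      -- (G4)(II): the sum over Σ(dom f) (finite, as the sum is required to
      -- be a positive integer) equals deg f
      G4-II  : ∀ {X Y} (y : InD Y) (f : Hom X Y) →
               Σ ℕ λ n → Σ (Fin n ↔ SigIdx X) λ e →
                 deg y f ≡ sumFin n (λ k → deg y (f ∘ sigArr (Inverse.to e k)))
      G4-III : ∀ {A B C} (a : InD A) (b : InD B) (c : InD C)
               (f : Hom B A) (g : Hom C A) (P : Pullback f g) →
               (deg a f ≡ deg c (Pullback.q P)) × (deg a g ≡ deg b (Pullback.p P))

{-# OPTIONS --safe #-}
-- Precomposing with q ∘ i embeds Hom(g, f) into Hom(g ∘ q ∘ i, f), since covers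
-- are epic. The arrow p ∘ i of Hom(g ∘ q ∘ i, f) is not in the image: if
-- h ∘ q ∘ i = p ∘ i, the pair (h, id) gives a section s of q with s ∘ q ∘ i = i,
-- and the uniqueness in (G3) forces s to factor through i. Then q ∘ i is a split
-- epimorphism, so its degree divides deg id = 1, contradicting deg (q ∘ i) > 1.
module Submission where

open import Defs
open import Level using (Level)
open import Data.Nat using (_<_; _*_; >-nonZero)
open import Data.Nat.Properties using (*-identityʳ; *-cancelˡ-≡; m*n≡1⇒m≡1; <⇒≢)
open import Data.Product using (Σ; _,_; proj₁; proj₂)
open import Data.Empty using (⊥)
open import Relation.Binary.PropositionalEquality
open ≡-Reasoning

idempotent-pos⇒1 : ∀ n → 0 < n → n ≡ n * n → n ≡ 1
idempotent-pos⇒1 n 0<n n≡n*n =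
  sym (*-cancelˡ-≡ 1 n n {{>-nonZero 0<n}} (trans (*-identityʳ n) n≡n*n))

module _ {o ℓ : Level} (𝒞 : Category o ℓ) where
  open Category 𝒞
  open CatDefs 𝒞

  HomOver-∘ʳ : ∀ {A B C D} {g : Hom C A} {f : Hom B A} (k : Hom D C) →
               HomOver g f → HomOver (g ∘ k) f
  HomOver-∘ʳ {g = g} {f} k (h , g≡fh) = h ∘ k , (begin
    g ∘ k        ≡⟨ cong (_∘ k) g≡fh ⟩
    (f ∘ h) ∘ k  ≡⟨ assoc f h k ⟩
    f ∘ (h ∘ k)  ∎)

  module _ {A B C} {f : Hom B A} {g : Hom C A} (P : Pullback f g) where
    open Pullback P

    pullback-comm-∘ : ∀ {W} (u : Hom W U) → f ∘ (p ∘ u) ≡ g ∘ (q ∘ u)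
    pullback-comm-∘ u = begin
      f ∘ (p ∘ u)  ≡⟨ assoc f p u ⟨
      (f ∘ p) ∘ u  ≡⟨ cong (_∘ u) comm ⟩
      (g ∘ q) ∘ u  ≡⟨ assoc g q u ⟩
      g ∘ (q ∘ u)  ∎

    pullback-jointly-monic : ∀ {W} (u v : Hom W U) →
                             p ∘ u ≡ p ∘ v → q ∘ u ≡ q ∘ v → u ≡ v
    pullback-jointly-monic u v pu≡pv qu≡qv =
      trans (unique u refl refl) (sym (unique v (sym pu≡pv) (sym qu≡qv)))
      where unique = proj₂ (proj₂ (proj₂ (universal (p ∘ u) (q ∘ u) (pullback-comm-∘ u))))

  module _ {d s : Level} (S : Setting d s) where
    open Setting S

    deg-id : ∀ {Y} (y : InD Y) → deg y (id {Y}) ≡ 1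
    deg-id y = idempotent-pos⇒1 _ (deg-pos y id) (begin
      deg y id         ≡⟨ cong (deg y) (idˡ id) ⟨
      deg y (id ∘ id)  ≡⟨ G4-I y y id id ⟩
      deg y id * deg y id ∎)

    deg-splitEpi≡1 : ∀ {X Y} (x : InD X) (y : InD Y) (e : Hom X Y) (t : Hom Y X) →
                     e ∘ t ≡ id → deg y e ≡ 1
    deg-splitEpi≡1 x y e t e∘t≡id = m*n≡1⇒m≡1 (deg y e) (deg x t) (begin
      deg y e * deg x t  ≡⟨ G4-I x y t e ⟨
      deg y (e ∘ t)      ≡⟨ cong (deg y) e∘t≡id ⟩
      deg y id           ≡⟨ deg-id y ⟩
      1                  ∎)

    factors-through-sigArr : ∀ {U X} → InD X → (u : Hom X U) (i : SigIdx U) →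
                             HomOver (sigArr i) u → HomOver u (sigArr i)
    factors-through-sigArr x u i (w , i≡uw) = subst (λ j → HomOver u (sigArr j)) j≡i u≤j
      where
        j   = proj₁ (G3 x u)
        u≤j = proj₁ (proj₂ (G3 x u))
        i≤j : HomOver (sigArr i) (sigArr j)
        i≤j = subst (λ v → HomOver v (sigArr j)) (sym i≡uw) (HomOver-∘ʳ w u≤j)
        unique = proj₂ (proj₂ (G3 (sigInD i) (sigArr i)))
        j≡i : j ≡ i
        j≡i = trans (unique j i≤j)
                    (sym (unique i (id , sym (idʳ (sigArr i)))))

    module _ {A B C} (c : InD C) {f : Hom B A} {g : Hom C A} (P : Pullback f g)
             (i : SigIdx (Pullback.U P)) where
      open Pullback P

      q∘sigArr-split : (h : HomOver g f) → proj₁ h ∘ (q ∘ sigArr i) ≡ p ∘ sigArr i →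
                       Σ (Hom C (sigDom i)) λ t → (q ∘ sigArr i) ∘ t ≡ id
      q∘sigArr-split (h , g≡fh) h∘qι≡pι = t , (begin
        (q ∘ ι) ∘ t  ≡⟨ assoc q ι t ⟩
        q ∘ (ι ∘ t)  ≡⟨ cong (q ∘_) σ≡ιt ⟨
        q ∘ σ        ≡⟨ qσ≡id ⟩
        id           ∎)
        where
          ι = sigArr i
          lift = universal h id (trans (sym g≡fh) (sym (idʳ g)))
          σ = proj₁ lift
          pσ≡h = proj₁ (proj₂ lift)
          qσ≡id = proj₁ (proj₂ (proj₂ lift))
          σqι≡ι : σ ∘ (q ∘ ι) ≡ ι
          σqι≡ι = pullback-jointly-monic P (σ ∘ (q ∘ ι)) ι
            (begin
              p ∘ (σ ∘ (q ∘ ι))  ≡⟨ assoc p σ (q ∘ ι) ⟨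
              (p ∘ σ) ∘ (q ∘ ι)  ≡⟨ cong (_∘ (q ∘ ι)) pσ≡h ⟩
              h ∘ (q ∘ ι)        ≡⟨ h∘qι≡pι ⟩
              p ∘ ι              ∎)
            (begin
              q ∘ (σ ∘ (q ∘ ι))  ≡⟨ assoc q σ (q ∘ ι) ⟨
              (q ∘ σ) ∘ (q ∘ ι)  ≡⟨ cong (_∘ (q ∘ ι)) qσ≡id ⟩
              id ∘ (q ∘ ι)       ≡⟨ idˡ (q ∘ ι) ⟩
              q ∘ ι              ∎)
          σ≤ι = factors-through-sigArr c σ i (q ∘ ι , sym σqι≡ι)
          t = proj₁ σ≤ι
          σ≡ιt = proj₂ σ≤ι

lemma4p1 : ∀ {o ℓ d s : Level} (𝒞 : Category o ℓ) (S : CatDefs.Setting 𝒞 d s) →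
  let open Category 𝒞
      open CatDefs 𝒞
      open Setting S
  in ∀ {A B C} (a : InD A) (b : InD B) (c : InD C)
       (f : Hom B A) (g : Hom C A) (P : Pullback f g)
       (i : SigIdx (Pullback.U P)) →
       1 < deg c (Pullback.q P ∘ sigArr i) →
       HomCardSucLE g f (g ∘ (Pullback.q P ∘ sigArr i)) f
lemma4p1 𝒞 S _ b c f g P i 1<deg =
  HomOver-∘ʳ 𝒞 qι , injective , (p ∘ ι , sym (pullback-comm-∘ 𝒞 P ι)) , outside
  where
    open Category 𝒞
    open CatDefs 𝒞
    open Setting S
    open Pullback P
    ι = sigArr i
    qι = q ∘ ι

    injective : ∀ h h' → proj₁ h ∘ qι ≡ proj₁ h' ∘ qι → proj₁ h ≡ proj₁ h'
    injective (h , _) (h' , _) = G2-II (sigInD i) c qι b h h'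

    outside : ∀ h → proj₁ h ∘ qι ≡ p ∘ ι → ⊥
    outside h h∘qι≡pι with q∘sigArr-split 𝒞 S c P i h h∘qι≡pι
    ... | t , qιt≡id = <⇒≢ 1<deg (sym (deg-splitEpi≡1 𝒞 S (sigInD i) c qι t qιt≡id))
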